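{- Let $[\alpha,\beta]$ be a free interval of $w_0$ and let $\mu,\nu$ satisfy $\min\{\alpha,\beta\}\le\mu,\nu\le\max\{\alpha,\beta\}$. Then $[\mu,\nu]$ is a free interval.
   Context: Let $\Gamma_0$ be a finite alphabet with involution $a\mapsto\overline a$ (fixed points allowed), extended to words by $\overline{a_1\cdots a_k}=\overline{a_k}\cdots\overline{a_1}$, and $\Omega_0$ a finite set of variables with fixed-point-free involution. Let $x_1,\dots,x_d\in\Gamma_0\cup\Omega_0$ with $2\le g<d$, and let $\sigma:\Omega_0\to\Gamma_0^*$ with $\sigma(\overline X)=\overline{\sigma(X)}$ (extended to a homomorphism fixing $\Gamma_0$) satisfy $\sigma(x_1\cdots x_g)=\sigma(x_{g+1}\cdots x_d)=:w_0$ and $\sigma(x_i)\ne1$ for all $i$. Let $m_0=|w_0|$. Positions of $w=a_1\cdots a_m$ are $0,\dots,m$; for $0\le\alpha<\beta\le m$ set $w[\alpha,\beta]=a_{\alpha+1}\cdots a_\beta$ (a positive interval), $w[\beta,\alpha]=\overline{w[\alpha,\beta]}$, $w[\alpha,\alpha]=1$; an interval is any pair $[\alpha,\beta]$ of positions. For $1\le i\le g$ let $\mathrm{l}(i)=|\sigma(x_1\cdots x_{i-1})|$, for $g<i\le d$ let $\mathrm{l}(i)=|\sigma(x_{g+1}\cdots x_{i-1})|$, and $\mathrm{r}(i)=\mathrm{l}(i)+|\sigma(x_i)|$, so $\sigma(x_i)=w_0[\mathrm{l}(i),\mathrm{r}(i)]$. The cuts are the positions $\mathrm{l}(i),\mathrm{r}(i)$,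 $1\le i\le d$. For $i,j$ and $\mu,\nu\in\{0,\dots,\mathrm{r}(i)-\mathrm{l}(i)\}$ define $[\mathrm{l}(i)+\mu,\mathrm{l}(i)+\nu]\sim[\mathrm{l}(j)+\mu,\mathrm{l}(j)+\nu]$ if $x_i=x_j$, and $[\mathrm{l}(i)+\mu,\mathrm{l}(i)+\nu]\sim[\mathrm{r}(j)-\mu,\mathrm{r}(j)-\nu]$ if $x_i=\overline{x_j}$; let $\approx$ be the reflexive transitive closure of $\sim$. An interval $[\alpha,\beta]$ is free if for every $[\alpha',\beta']\approx[\alpha,\beta]$ there is no cut $\gamma'$ with $\min\{\alpha',\beta'\}<\gamma'<\max\{\alpha',\beta'\}$. -}

module Defs where

open import Data.Nat using (ℕ; _+_; _∸_; _≤_; _<_; _⊓_; _⊔_)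
open import Data.Fin using (Fin; toℕ)
open import Data.List using (List; []; _∷_; map; reverse; concatMap; take; drop; length; tabulate)
open import Data.Sum using (_⊎_; inj₁; inj₂)
open import Data.Product using (_×_; _,_; ∃)
open import Relation.Binary.PropositionalEquality using (_≡_; _≢_)
open import Relation.Nullary using (¬_)
open import Relation.Binary.Construct.Closure.ReflexiveTransitive using (Star)

-- Γ₀ = Fin n (finite alphabet), Ω₀ = Fin k (finite set of variables).
-- A letter of the equation is an element of Γ₀ ⊎ Ω₀.

barWord : ∀ {n} → (Fin n → Fin n) → List (Fin n) → List (Fin n)
barWord bar w = reverse (map bar w)

barLetter : ∀ {n k} → (Fin n → Fin n) → (Fin k → Fin k) → Fin n ⊎ Fin k → Fin n ⊎ Fin k
barLetter bΓ bΩ (inj₁ a) = inj₁ (bΓ a)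
barLetter bΓ bΩ (inj₂ X) = inj₂ (bΩ X)

σLetter : ∀ {n k} → (Fin k → List (Fin n)) → Fin n ⊎ Fin k → List (Fin n)
σLetter σ (inj₁ a) = a ∷ []
σLetter σ (inj₂ X) = σ X

σWord : ∀ {n k} → (Fin k → List (Fin n)) → List (Fin n ⊎ Fin k) → List (Fin n)
σWord σ = concatMap (σLetter σ)

-- The standing setup. Indices i ∈ {1,…,d} are represented by Fin d (index i ↦ i-1).
record Setup : Set where
  field
    n k d g : ℕ
    barΓ      : Fin n → Fin n
    barΓ-inv  : ∀ a → barΓ (barΓ a) ≡ a
    barΩ      : Fin k → Fin k
    barΩ-inv  : ∀ X → barΩ (barΩ X) ≡ X
    barΩ-free : ∀ X → barΩ X ≢ X
    x         : Fin d → Fin n ⊎ Fin k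
    σ         : Fin k → List (Fin n)
    σ-bar     : ∀ X → σ (barΩ X) ≡ barWord barΓ (σ X)
    2≤g       : 2 ≤ g
    g<d       : g < d
    equation  : σWord σ (take g (tabulate x)) ≡ σWord σ (drop g (tabulate x))
    nonempty  : ∀ i → σLetter σ (x i) ≢ []

module _ (S : Setup) where
  open Setup S

  xs : List (Fin n ⊎ Fin k)
  xs = tabulate x

  w₀ : List (Fin n)
  w₀ = σWord σ (take g xs)

  m₀ : ℕ
  m₀ = length w₀

  lpos : Fin d → ℕ
  lpos i with toℕ i Data.Nat.<? g
  ... | Relation.Nullary.yes _ = length (σWord σ (take (toℕ i) xs))
  ... | Relation.Nullary.no  _ = length (σWord σ (take (toℕ i ∸ g) (drop g xs)))

  rpos : Fin d → ℕ
  rpos i = lpos i + length (σLetter σ (x i))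

  Cut : ℕ → Set
  Cut γ = ∃ λ i → γ ≡ lpos i ⊎ γ ≡ rpos i

  Interval : Set
  Interval = ℕ × ℕ

  data _∼_ : Interval → Interval → Set where
    same : ∀ i j μ ν → μ ≤ rpos i ∸ lpos i → ν ≤ rpos i ∸ lpos i →
           x i ≡ x j →
           (lpos i + μ , lpos i + ν) ∼ (lpos j + μ , lpos j + ν)
    opp  : ∀ i j μ ν → μ ≤ rpos i ∸ lpos i → ν ≤ rpos i ∸ lpos i →
           x i ≡ barLetter barΓ barΩ (x j) →
           (lpos i + μ , lpos i + ν) ∼ (rpos j ∸ μ , rpos j ∸ ν)

  _≈I_ : Interval → Interval → Set
  _≈I_ = Star _∼_

  Free : ℕ → ℕ → Set
  Free α β = ∀ α' β' → (α , β) ≈I (α' , β') →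
             ∀ γ → Cut γ → ¬ ((α' ⊓ β' < γ) × (γ < α' ⊔ β'))

{-# OPTIONS --safe #-}
-- Following a chain [μ, ν] ∼ ⋯ ∼ q step by step, we carry along an interval
-- t ≈ [α, β] containing the current interval p. Each step p ∼ p' is induced by a
-- letter x_i whose span [l(i), r(i)] contains p; if p is nondegenerate, the cuts
-- l(i), r(i) cannot lie strictly inside the free interval t, so t also lies in that
-- span and the same step carries t to some t' ⊇ p'. Once p becomes degenerate it
-- stays so, and a degenerate interval contains no cut.
module Submission where

open import Defs
open import Data.Fin using (Fin)
open import Data.Nat using (ℕ; _+_; _∸_; _≤_; _<_; _≥_; _⊓_; _⊔_; _≟_)
open import Data.Nat.Properties
open import Data.Product using (_×_; _,_; ∃₂) renaming (map to map×)
open import Data.Sum using (_⊎_; inj₁; inj₂) renaming (map₂ to map⊎₂)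
open import Relation.Binary.Core using (_Preserves_⟶_)
open import Relation.Binary.Definitions using (tri<; tri≈; tri>)
open import Relation.Binary.PropositionalEquality using (_≡_; _≢_; refl; cong; cong₂; subst; sym)
open import Relation.Binary.Construct.Closure.ReflexiveTransitive using (ε; _◅_)
open import Relation.Nullary using (¬_; yes; no; contradiction)

Between : ℕ → ℕ → ℕ → Set
Between μ α β = α ⊓ β ≤ μ × μ ≤ α ⊔ β

StrictlyBetween : ℕ → ℕ → ℕ → Set
StrictlyBetween γ α β = α ⊓ β < γ × γ < α ⊔ β

between-mono : ∀ {f} → f Preserves _≤_ ⟶ _≤_ →
               ∀ {μ α β} → Between μ α β → Between (f μ) (f α) (f β)
between-mono {f} f-mono {μ} {α} {β} (lo , hi) =
  subst (_≤ f μ) (mono-≤-distrib-⊓ f-mono α β) (f-mono lo) ,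
  subst (f μ ≤_) (mono-≤-distrib-⊔ f-mono α β) (f-mono hi)

between-antimono : ∀ {f} → f Preserves _≤_ ⟶ _≥_ →
                   ∀ {μ α β} → Between μ α β → Between (f μ) (f α) (f β)
between-antimono {f} f-anti {μ} {α} {β} (lo , hi) =
  subst (_≤ f μ) (antimono-≤-distrib-⊔ f-anti α β) (f-anti hi) ,
  subst (f μ ≤_) (antimono-≤-distrib-⊓ f-anti α β) (f-anti lo)

between-cancelˡ-+ : ∀ k {μ α β} → Between (k + μ) (k + α) (k + β) → Between μ α β
between-cancelˡ-+ k {μ} {α} {β} (lo , hi) =
  +-cancelˡ-≤ k _ _ (subst (_≤ k + μ) (sym (+-distribˡ-⊓ k α β)) lo) ,
  +-cancelˡ-≤ k _ _ (subst (k + μ ≤_) (sym (+-distribˡ-⊔ k α β)) hi)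

strictlyBetween-⊆ : ∀ {γ μ ν α β} → Between μ α β → Between ν α β →
                    StrictlyBetween γ μ ν → StrictlyBetween γ α β
strictlyBetween-⊆ (μ-lo , μ-hi) (ν-lo , ν-hi) (lo<γ , γ<hi) =
  ≤-<-trans (⊓-glb μ-lo ν-lo) lo<γ , <-≤-trans γ<hi (⊔-lub μ-hi ν-hi)

¬strictlyBetween-≡ : ∀ {γ μ ν} → μ ≡ ν → ¬ StrictlyBetween γ μ ν
¬strictlyBetween-≡ {γ} {μ} refl (lo<γ , γ<hi) =
  <-asym (subst (_< γ) (⊓-idem μ) lo<γ) (subst (γ <_) (⊔-idem μ) γ<hi)

≢⇒⊓<⊔ : ∀ {μ ν} → μ ≢ ν → μ ⊓ ν < μ ⊔ ν
≢⇒⊓<⊔ {μ} {ν} μ≢ν with <-cmp μ ν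
... | tri< μ<ν _ _ = ≤-<-trans (m⊓n≤m μ ν) (<-≤-trans μ<ν (m≤n⊔m μ ν))
... | tri≈ _ μ≡ν _ = contradiction μ≡ν μ≢ν
... | tri> _ _ ν<μ = ≤-<-trans (m⊓n≤n μ ν) (<-≤-trans ν<μ (m≤m⊔n μ ν))

between-⊆-span : ∀ {l r μ ν α β} → μ ≢ ν → Between μ α β → Between ν α β →
                 l ≤ μ ⊓ ν → μ ⊔ ν ≤ r →
                 ¬ StrictlyBetween l α β → ¬ StrictlyBetween r α β →
                 l ≤ α ⊓ β × α ⊔ β ≤ r
between-⊆-span {l} {r} {α = α} {β} μ≢ν (μ-lo , μ-hi) (ν-lo , ν-hi)
               l≤μν μν≤r l-outside r-outside =
  ≮⇒≥ (λ lo<l → l-outside (lo<l , l<hi)) , ≮⇒≥ (λ r<hi → r-outside (lo<r , r<hi))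
  where
    l<hi : l < α ⊔ β
    l<hi = ≤-<-trans l≤μν (<-≤-trans (≢⇒⊓<⊔ μ≢ν) (⊔-lub μ-hi ν-hi))
    lo<r : α ⊓ β < r
    lo<r = ≤-<-trans (⊓-glb μ-lo ν-lo) (<-≤-trans (≢⇒⊓<⊔ μ≢ν) μν≤r)

module _ (S : Setup) where
  open Setup S using (d)

  private
    l r : Fin d → ℕ
    l = lpos S
    r = rpos S

    _∼′_ _≈′_ : Interval S → Interval S → Set
    _∼′_ = _∼_ S
    _≈′_ = _≈I_ S

  Degenerate : Interval S → Set
  Degenerate (μ , ν) = μ ≡ ν

  ∼-degenerate : ∀ {p q} → p ∼′ q → Degenerate p → Degenerate q
  ∼-degenerate (same i j a b _ _ _) e = cong (l j +_) (+-cancelˡ-≡ (l i) a b e)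
  ∼-degenerate (opp i j a b _ _ _) e = cong (r j ∸_) (+-cancelˡ-≡ (l i) a b e)

  ≈-degenerate : ∀ {p q} → p ≈′ q → Degenerate p → Degenerate q
  ≈-degenerate ε e = e
  ≈-degenerate (s ◅ rest) e = ≈-degenerate rest (∼-degenerate s e)

  _⊑_ : Interval S → Interval S → Set
  (μ , ν) ⊑ (α , β) = Between μ α β × Between ν α β

  data InSpan (i : Fin d) : Interval S → Set where
    offsets : ∀ a b → a ≤ r i ∸ l i → b ≤ r i ∸ l i → InSpan i (l i + a , l i + b)

  offset≤rpos : ∀ {i a} → a ≤ r i ∸ l i → l i + a ≤ r i
  offset≤rpos {i} a≤ =
    ≤-trans (+-monoʳ-≤ (l i) a≤) (≤-reflexive (m+[n∸m]≡n (m≤m+n (l i) _)))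

  inSpan : ∀ {i α β} → l i ≤ α ⊓ β → α ⊔ β ≤ r i → InSpan i (α , β)
  inSpan {i} {α} {β} l≤ ≤r =
    subst (InSpan i) (cong₂ _,_ (m+[n∸m]≡n l≤α) (m+[n∸m]≡n l≤β))
      (offsets _ _ (∸-monoˡ-≤ (l i) (≤-trans (m≤m⊔n α β) ≤r))
                   (∸-monoˡ-≤ (l i) (≤-trans (m≤n⊔m α β) ≤r)))
    where
      l≤α : l i ≤ α
      l≤α = ≤-trans l≤ (m⊓n≤m α β)
      l≤β : l i ≤ β
      l≤β = ≤-trans l≤ (m⊓n≤n α β)

  free-∼ : ∀ {α β α₁ β₁} → Free S α β → (α , β) ∼′ (α₁ , β₁) → Free S α₁ β₁
  free-∼ F s α' β' chain = F α' β' (s ◅ chain)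

  free-⊆-span : ∀ {α β} i a b → Free S α β → l i + a ≢ l i + b →
                a ≤ r i ∸ l i → b ≤ r i ∸ l i →
                (l i + a , l i + b) ⊑ (α , β) → InSpan i (α , β)
  free-⊆-span {α} {β} i a b F ne a≤ b≤ (μ-in , ν-in) =
    let (l≤ , ≤r) = between-⊆-span ne μ-in ν-in
                      (⊓-glb (m≤m+n (l i) a) (m≤m+n (l i) b))
                      (⊔-lub (offset≤rpos a≤) (offset≤rpos b≤))
                      (F α β ε (l i) (i , inj₁ refl))
                      (F α β ε (r i) (i , inj₂ refl))
    in inSpan l≤ ≤r

  ∼-covered : ∀ {α β μ ν q} → Free S α β → (μ , ν) ⊑ (α , β) → μ ≢ ν →
              (μ , ν) ∼′ q → ∃₂ λ α₁ β₁ → (α , β) ∼′ (α₁ , β₁) × q ⊑ (α₁ , β₁)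
  ∼-covered F p⊑t ne (same i j a b a≤ b≤ e)
    with free-⊆-span i a b F ne a≤ b≤ p⊑t
  ... | offsets a′ b′ a′≤ b′≤ =
    _ , _ , same i j a′ b′ a′≤ b′≤ e ,
    map× shift shift p⊑t
    where
      shift : ∀ {μ} → Between (l i + μ) (l i + a′) (l i + b′) →
                      Between (l j + μ) (l j + a′) (l j + b′)
      shift h = between-mono (+-monoʳ-≤ (l j)) (between-cancelˡ-+ (l i) h)
  ∼-covered F p⊑t ne (opp i j a b a≤ b≤ e)
    with free-⊆-span i a b F ne a≤ b≤ p⊑t
  ... | offsets a′ b′ a′≤ b′≤ =
    _ , _ , opp i j a′ b′ a′≤ b′≤ e ,
    map× reflect reflect p⊑t
    where
      reflect : ∀ {μ} → Between (l i + μ) (l i + a′) (l i + b′) →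
                        Between (r j ∸ μ) (r j ∸ a′) (r j ∸ b′)
      reflect h = between-antimono (∸-monoʳ-≤ (r j)) (between-cancelˡ-+ (l i) h)

  ≈-covered : ∀ {α β p q} → Free S α β → p ⊑ (α , β) → p ≈′ q →
              Degenerate q ⊎ ∃₂ λ α₁ β₁ → (α , β) ≈′ (α₁ , β₁) × q ⊑ (α₁ , β₁)
  ≈-covered F p⊑t ε = inj₂ (_ , _ , ε , p⊑t)
  ≈-covered {p = μ , ν} F p⊑t (s ◅ rest) with μ ≟ ν
  ... | yes μ≡ν = inj₁ (≈-degenerate (s ◅ rest) μ≡ν)
  ... | no μ≢ν with ∼-covered F p⊑t μ≢ν s
  ...   | _ , _ , t∼t₁ , p′⊑t₁ =
    map⊎₂ (λ (α₂ , β₂ , t₁≈t₂ , q⊑t₂) → α₂ , β₂ , t∼t₁ ◅ t₁≈t₂ , q⊑t₂)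
          (≈-covered (free-∼ F t∼t₁) p′⊑t₁ rest)

lemma10 : (S : Setup) (α β μ ν : ℕ) →
          α ≤ m₀ S → β ≤ m₀ S → Free S α β →
          α ⊓ β ≤ μ → μ ≤ α ⊔ β → α ⊓ β ≤ ν → ν ≤ α ⊔ β →
          Free S μ ν
lemma10 S α β μ ν _ _ F μ-lo μ-hi ν-lo ν-hi α' β' chain γ cut inside
  with ≈-covered S F ((μ-lo , μ-hi) , (ν-lo , ν-hi)) chain
... | inj₁ α'≡β' = ¬strictlyBetween-≡ α'≡β' inside
... | inj₂ (α₁ , β₁ , t≈t₁ , (α'-in , β'-in)) =
  F α₁ β₁ t≈t₁ γ cut (strictlyBetween-⊆ α'-in β'-in inside)
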